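{- Let $\mathfrak{X}=\langle X,\tau^0,\tau^1\rangle$ be the ultrabouquet built from $\{\langle X_n,\tau^0_n,\tau^1_n\rangle\}_{n\in\mathbb{N}}$ as described in the context. If an $\mathcal{L}(\Box,\rhd)$-formula $\varphi$ is valid in every $\langle X_n,\tau^0_n,\tau^1_n\rangle$, then $\varphi$ is also valid in $\mathfrak{X}$.
   Context: $\mathcal{L}(\Box,\rhd)$ has propositional variables, $\top,\bot$, $\neg,\land,\lor,\to$, unary $\Box,\Diamond$, binary $\rhd$. For a topology $\tau$ on $X$, $d_\tau(Y)=\{x: \text{every } U\in\tau \text{ containing } x \text{ meets } Y\setminus\{x\}\}$, $cd_\tau(Y)=X\setminus d_\tau(X\setminus Y)$; $\langle X,\tau\rangle$ is scattered if $Y\setminus d_\tau(Y)\neq\varnothing$ for every nonempty $Y$. A bitopological space is $\langle X,\tau^0,\tau^1\rangle$ with $X\ne\varnothing$ and $\tau^0,\tau^1$ topologies; $e_{\tau^0,\tau^1}(Y,Z)=\{x:\forall U\in\tau^1[x\in d_{\tau^0}(Y\cap U)\Rightarrow x\in d_{\tau^0}(Z\cap U)]\}$; a valuation $v$ maps formulas to subsets of $X$, Boolean on connectives, with $v(\Box\varphi)=cd_{\tau^0}(v(\varphi))$, $v(\Diamond\varphi)=d_{\tau^0}(v(\varphi))$, $v(\varphi\rhd\psi)=e_{\tau^0,\tau^1}(v(\varphi),v(\psi))$; $\varphi$ is valid in the space if $v(\varphi)=X$ for every valuation $v$. Ultrabouquet: $\{\langle X_n,\tau^0_n,\tau^1_n\rangle\}_{n\in\mathbb{N}}$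 are bitopological spaces with each $\langle X_n,\tau^0_n\rangle$ scattered and the $X_n$ pairwise disjoint; $x_n\in X_n$; $Y_n\subseteq X_n$ with $x_n\in Y_n\in\tau^0_n$ and $Y_n\setminus\{x_n\}\in\tau^0_n$; $\mathcal{U}$ a non-principal ultrafilter on $\mathbb{N}$; $x_\ast\notin\bigcup_nX_n$ a new point. $X=\bigcup_n(X_n\setminus\{x_n\})\cup\{x_\ast\}$. For $V\subseteq X$, $V\restriction X_n=V\cap X_n$ if $x_\ast\notin V$, and $((V\setminus\{x_\ast\})\cup\{x_n\})\cap X_n$ if $x_\ast\in V$; $V\restriction Y_n$ likewise with $Y_n$. $U\in\tau^0$ iff (i) $U\cap(Y_n\setminus\{x_n\})\in\tau^0_n$ for all $n$ and (ii) if $x_\ast\in U$ then $\{n:U\restriction Y_n\in\tau^0_n\}\in\mathcal{U}$; $U\in\tau^1$ iff $U\restriction X_n\in\tau^1_n$ for all $n$. $\mathfrak{X}=\langle X,\tau^0,\tau^1\rangle$ is a bitopological space. -}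

module Defs where

open import Level using (Level; 0ℓ)
open import Data.Nat using (ℕ)
open import Data.Bool using (Bool; true; false)
open import Data.Product using (Σ; ∃; _×_; _,_)
open import Data.Sum using (_⊎_)
open import Data.Unit using (⊤)
open import Data.Empty using (⊥)
open import Relation.Nullary using (¬_)
open import Relation.Binary.PropositionalEquality using (_≡_; _≢_)
open import Function.Bundles using (_⇔_)

-- Open sets are represented by characteristic functions
-- X → Bool (so that quantifying over open sets stays in Set); classically
-- (the paper's setting) every subset has a characteristic function.

Subset : Set → Set₁
Subset X = X → Set

OpenP : {X : Set} → ((X → Bool) → Set) → Subset X → Set
OpenP {X} O P = ∃ λ (W : X → Bool) → O W × (∀ p → (W p ≡ true ⇔ P p))

record IsTopology {X : Set} (O : (X → Bool) → Set) : Set₁ where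
  field
    empty-open : ∀ W → (∀ x → W x ≡ false) → O W
    whole-open : ∀ W → (∀ x → W x ≡ true) → O W
    inter-open : ∀ U V W → O U → O V →
                 (∀ x → (W x ≡ true ⇔ (U x ≡ true × V x ≡ true))) → O W
    union-open : (I : Set) (F : I → X → Bool) → (∀ i → O (F i)) →
                 ∀ W → (∀ x → (W x ≡ true ⇔ (∃ λ i → F i x ≡ true))) → O W

record BiSpace : Set₁ where
  field
    Carrier : Set
    point   : Carrier
    O0      : (Carrier → Bool) → Set
    O1      : (Carrier → Bool) → Set
    top0    : IsTopology O0
    top1    : IsTopology O1

der : {X : Set} → ((X → Bool) → Set) → Subset X → Subset X
der {X} O Y x = ∀ (U : X → Bool) → O U → U x ≡ true →
                ∃ λ y → U y ≡ true × Y y × y ≢ x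

coder : {X : Set} → ((X → Bool) → Set) → Subset X → Subset X
coder O Y x = ¬ der O (λ y → ¬ Y y) x

Scattered : {X : Set} → ((X → Bool) → Set) → Set₁
Scattered {X} O = ∀ (Y : Subset X) → (∃ λ y → Y y) → ∃ λ y → Y y × ¬ der O Y y

data Formula : Set where
  var       : ℕ → Formula
  ⊤f ⊥f     : Formula
  ¬f_       : Formula → Formula
  _∧f_ _∨f_ _⇒f_ : Formula → Formula → Formula
  □f_ ◇f_   : Formula → Formula
  _▷f_      : Formula → Formula → Formula

module Semantics {X : Set} (O0 O1 : (X → Bool) → Set) where

  e : Subset X → Subset X → Subset X
  e Y Z x = ∀ (U : X → Bool) → O1 U →
            der O0 (λ y → Y y × U y ≡ true) x → der O0 (λ y → Z y × U y ≡ true) x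

  ⟦_⟧ : Formula → (ℕ → Subset X) → Subset X
  ⟦ var i ⟧ V x = V i x
  ⟦ ⊤f ⟧ V x = ⊤
  ⟦ ⊥f ⟧ V x = ⊥
  ⟦ ¬f φ ⟧ V x = ¬ ⟦ φ ⟧ V x
  ⟦ φ ∧f ψ ⟧ V x = ⟦ φ ⟧ V x × ⟦ ψ ⟧ V x
  ⟦ φ ∨f ψ ⟧ V x = ⟦ φ ⟧ V x ⊎ ⟦ ψ ⟧ V x
  ⟦ φ ⇒f ψ ⟧ V x = ⟦ φ ⟧ V x → ⟦ ψ ⟧ V x
  ⟦ □f φ ⟧ V x = coder O0 (⟦ φ ⟧ V) x
  ⟦ ◇f φ ⟧ V x = der O0 (⟦ φ ⟧ V) x
  ⟦ φ ▷f ψ ⟧ V x = e (⟦ φ ⟧ V) (⟦ ψ ⟧ V) x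

  Valid : Formula → Set₁
  Valid φ = ∀ (V : ℕ → Subset X) (x : X) → ⟦ φ ⟧ V x

ValidIn : BiSpace → Formula → Set₁
ValidIn S φ = Semantics.Valid (BiSpace.O0 S) (BiSpace.O1 S) φ

record NPUltrafilter : Set₁ where
  field
    mem          : (ℕ → Set) → Set
    upward       : ∀ A B → mem A → (∀ n → A n → B n) → mem B
    inter        : ∀ A B → mem A → mem B → mem (λ n → A n × B n)
    whole        : mem (λ _ → ⊤)
    proper       : ¬ mem (λ _ → ⊥)
    ultra        : ∀ A → mem A ⊎ mem (λ n → ¬ A n)
    nonprincipal : ∀ k → ¬ mem (λ n → n ≡ k)

-- The ultrabouquet.  The X_n are made pairwise disjoint by tagging with n.
-- X = ⋃ₙ (X_n ∖ {x_n}) ∪ {x_*}.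

module Ultrabouquet (S : ℕ → BiSpace)
                    (xs : (n : ℕ) → BiSpace.Carrier (S n))
                    (Ys : (n : ℕ) → BiSpace.Carrier (S n) → Bool)
                    (𝒰 : NPUltrafilter) where

  open BiSpace

  data Pt : Set where
    inn  : (n : ℕ) (p : Carrier (S n)) .(np : p ≢ xs n) → Pt
    star : Pt

  resX : (Pt → Bool) → (n : ℕ) → Subset (Carrier (S n))
  resX U n p = (p ≡ xs n × U star ≡ true)
             ⊎ (Σ (p ≢ xs n) λ np → U (inn n p np) ≡ true)

  resY : (Pt → Bool) → (n : ℕ) → Subset (Carrier (S n))
  resY U n p = Ys n p ≡ true × resX U n p

  cutY : (Pt → Bool) → (n : ℕ) → Subset (Carrier (S n))
  cutY U n p = Ys n p ≡ true × (Σ (p ≢ xs n) λ np → U (inn n p np) ≡ true)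

  τ0 : (Pt → Bool) → Set
  τ0 U = (∀ n → OpenP (O0 (S n)) (cutY U n))
       × (U star ≡ true → NPUltrafilter.mem 𝒰 (λ n → OpenP (O0 (S n)) (resY U n)))

  τ1 : (Pt → Bool) → Set
  τ1 U = ∀ n → OpenP (O1 (S n)) (resX U n)

  Valid : Formula → Set₁
  Valid φ = Semantics.Valid τ0 τ1 φ

-- Points of 𝔛 lying in no Y_n are τ⁰-isolated, as is some point of the scattered space X_0,
-- and at an isolated point every formula is evaluated propositionally.
-- Around a point of Y_n ∖ {x_n}, 𝔛 looks like X_n (Y_n ∖ {x_n} is open in both and every
-- τ¹_n-open set extends to a τ¹-open set), so formulas take the same value there as in X_n
-- under the restricted valuation.  At x_* a formula holds iff it holds at 𝒰-almost all x_n,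
-- a Łoś-type statement: for ◇ and ▷ a failure at 𝒰-many x_n is witnessed by open sets
-- chosen in each X_n and glued into one open set of 𝔛.

module Submission where

open import Defs
open import Data.Nat using (ℕ; _≟_)
open import Data.Bool using (Bool; true; false)
import Data.Bool as Bool
open import Data.Bool.Properties using (¬-not)
open import Data.Product using (Σ; ∃; _×_; _,_; proj₁; proj₂)
open import Data.Product.Function.NonDependent.Propositional using (_×-⇔_)
open import Data.Sum using (_⊎_; inj₁; inj₂)
open import Data.Sum.Function.Propositional using (_⊎-⇔_)
open import Data.Unit using (⊤; tt)
open import Data.Empty using (⊥; ⊥-elim; ⊥-elim-irr)
open import Relation.Nullary using (¬_; yes; no; does)
open import Relation.Nullary.Recomputable using (¬-recompute)
open import Relation.Binary.PropositionalEquality using (_≡_; _≢_; refl; sym; trans; subst)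
open import Function.Bundles using (_⇔_; mk⇔; Equivalence)
open import Function.Construct.Identity using (⇔-id)
open import Function.Construct.Composition using (_⇔-∘_)
open import Function.Related.TypeIsomorphisms using (¬-cong-⇔; →-cong-⇔)
open import Axiom.ExcludedMiddle using (ExcludedMiddle)

open Equivalence using (to; from)

module _ {X : Set} {O : (X → Bool) → Set} where

  OpenP-resp : {P Q : Subset X} → OpenP O P → (∀ x → P x ⇔ Q x) → OpenP O Q
  OpenP-resp (W , OW , W⇔P) P⇔Q = W , OW , λ x →
    mk⇔ (λ w → to (P⇔Q x) (to (W⇔P x) w)) (λ q → from (W⇔P x) (from (P⇔Q x) q))

  OpenP-char : {W : X → Bool} → O W → OpenP O (λ x → W x ≡ true)
  OpenP-char {W} OW = W , OW , λ x → ⇔-id _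

  OpenP-∅ : IsTopology O → OpenP O (λ _ → ⊥)
  OpenP-∅ top = _ , IsTopology.empty-open top (λ _ → false) (λ _ → refl) , λ x → mk⇔ (λ ()) ⊥-elim

  OpenP-whole : IsTopology O → OpenP O (λ _ → ⊤)
  OpenP-whole top = _ , IsTopology.whole-open top (λ _ → true) (λ _ → refl) , λ x → mk⇔ _ (λ _ → refl)

  der-mono : {A B : Subset X} {x : X} → der O A x → (∀ y → A y → B y) → der O B x
  der-mono d A⊆B U OU Ux with d U OU Ux
  ... | y , Uy , Ay , y≢x = y , Uy , A⊆B y Ay , y≢x

  der-OpenP : {A P : Subset X} {x : X} → der O A x → OpenP O P → P x → ∃ λ y → P y × A y × y ≢ x
  der-OpenP d (W , OW , W⇔P) Px with d W OW (from (W⇔P _) Px)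
  ... | y , Wy , Ay , y≢x = y , to (W⇔P y) Wy , Ay , y≢x

Isolated : {X : Set} → ((X → Bool) → Set) → X → Set₁
Isolated {X} O x = ∀ (A : Subset X) → ¬ der O A x

Isolating : {X : Set} → ((X → Bool) → Set) → Subset X → X → (X → Bool) → Set
Isolating O A x W = O W × W x ≡ true × (∀ y → W y ≡ true → A y → y ≢ x → ⊥)

Scattered⇒isolated : {X : Set} {O : (X → Bool) → Set} → Scattered O → X → ∃ (Isolated O)
Scattered⇒isolated {O = O} scat x with scat (λ _ → ⊤) (x , tt)
... | y , _ , y∉d = y , λ A d → y∉d (der-mono {O = O} d (λ _ _ → tt))

isolatedEval : Formula → (ℕ → Set) → Set
isolatedEval (var i) v = v i
isolatedEval ⊤f v = ⊤
isolatedEval ⊥f v = ⊥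
isolatedEval (¬f φ) v = ¬ isolatedEval φ v
isolatedEval (φ ∧f ψ) v = isolatedEval φ v × isolatedEval ψ v
isolatedEval (φ ∨f ψ) v = isolatedEval φ v ⊎ isolatedEval ψ v
isolatedEval (φ ⇒f ψ) v = isolatedEval φ v → isolatedEval ψ v
isolatedEval (□f φ) v = ⊤
isolatedEval (◇f φ) v = ⊥
isolatedEval (φ ▷f ψ) v = ⊤

module _ {X : Set} (O0 O1 : (X → Bool) → Set) where
  open Semantics O0 O1

  ⟦⟧-isolated : ∀ {x} → Isolated O0 x → ∀ φ V → ⟦ φ ⟧ V x ⇔ isolatedEval φ (λ i → V i x)
  ⟦⟧-isolated iso (var i) V = ⇔-id _
  ⟦⟧-isolated iso ⊤f V = ⇔-id _
  ⟦⟧-isolated iso ⊥f V = ⇔-id _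
  ⟦⟧-isolated iso (¬f φ) V = ¬-cong-⇔ (⟦⟧-isolated iso φ V)
  ⟦⟧-isolated iso (φ ∧f ψ) V = ⟦⟧-isolated iso φ V ×-⇔ ⟦⟧-isolated iso ψ V
  ⟦⟧-isolated iso (φ ∨f ψ) V = ⟦⟧-isolated iso φ V ⊎-⇔ ⟦⟧-isolated iso ψ V
  ⟦⟧-isolated iso (φ ⇒f ψ) V = →-cong-⇔ (⟦⟧-isolated iso φ V) (⟦⟧-isolated iso ψ V)
  ⟦⟧-isolated iso (□f φ) V = mk⇔ _ (λ _ → iso _)
  ⟦⟧-isolated iso (◇f φ) V = mk⇔ (iso _) ⊥-elim
  ⟦⟧-isolated iso (φ ▷f ψ) V = mk⇔ _ (λ _ U OU d → ⊥-elim (iso _ d))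

valid⇒isolatedEval : ∀ {S φ} → ValidIn S φ → ∃ (Isolated (BiSpace.O0 S)) → ∀ v → isolatedEval φ v
valid⇒isolatedEval {S} {φ} valid (y , iso) v =
  to (⟦⟧-isolated (BiSpace.O0 S) (BiSpace.O1 S) iso φ (λ i _ → v i)) (valid (λ i _ → v i) y)

module Classical (lem : ∀ {ℓ} → ExcludedMiddle ℓ) where

  χ : {X : Set} → Subset X → X → Bool
  χ P x = does (lem {P = P x})

  χ-⇔ : {X : Set} {P : Subset X} {x : X} → χ P x ≡ true ⇔ P x
  χ-⇔ {P = P} {x} with lem {P = P x}
  ... | yes p = mk⇔ (λ _ → p) (λ _ → refl)
  ... | no ¬p = mk⇔ (λ ()) (λ p → ⊥-elim (¬p p))

  module _ {X : Set} {O : (X → Bool) → Set} (top : IsTopology O) where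

    OpenP-∩ : {P Q : Subset X} → OpenP O P → OpenP O Q → OpenP O (λ x → P x × Q x)
    OpenP-∩ {P} {Q} (W , OW , W⇔P) (W' , OW' , W'⇔Q) =
      χ P∩Q , IsTopology.inter-open top W W' (χ P∩Q) OW OW' (λ x → mk⇔
        (λ e → let (p , q) = to (χ-⇔ {P = P∩Q}) e in from (W⇔P x) p , from (W'⇔Q x) q)
        (λ (w , w') → from (χ-⇔ {P = P∩Q}) (to (W⇔P x) w , to (W'⇔Q x) w'))) ,
      λ x → χ-⇔ {P = P∩Q}
      where
      P∩Q : Subset X
      P∩Q x = P x × Q x

    OpenP-const : (s : Set) → OpenP O (λ _ → s)
    OpenP-const s with lem {P = s}
    ... | yes t = OpenP-resp (OpenP-whole top) (λ _ → mk⇔ (λ _ → t) _)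
    ... | no ¬t = OpenP-resp (OpenP-∅ top) (λ _ → mk⇔ ⊥-elim ¬t)

  ¬der⇒isolating : {X : Set} {O : (X → Bool) → Set} {A : Subset X} {x : X} → ¬ der O A x →
                   Σ (X → Bool) (Isolating O A x)
  ¬der⇒isolating {X} {O} {A} {x} x∉d with lem {P = Σ (X → Bool) (Isolating O A x)}
  ... | yes nbhd = nbhd
  ... | no ¬nbhd = ⊥-elim (x∉d meets)
    where
    meets : der O A x
    meets W OW Wx with lem {P = ∃ λ y → W y ≡ true × A y × y ≢ x}
    ... | yes m = m
    ... | no ¬m = ⊥-elim (¬nbhd (W , OW , Wx , λ y Wy Ay y≢x → ¬m (y , Wy , Ay , y≢x)))

  module UltrafilterLemmas (𝒰 : NPUltrafilter) where
    open NPUltrafilter 𝒰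

    mem-resp : {A B : ℕ → Set} → (∀ n → A n ⇔ B n) → mem A ⇔ mem B
    mem-resp A⇔B = mk⇔ (λ a → upward _ _ a (λ n → to (A⇔B n)))
                       (λ b → upward _ _ b (λ n → from (A⇔B n)))

    mem⇒∃ : {A : ℕ → Set} → mem A → ∃ A
    mem⇒∃ {A} a with lem {P = ∃ A}
    ... | yes e = e
    ... | no ¬e = ⊥-elim (proper (upward _ _ a (λ n An → ¬e (n , An))))

    mem-∀ : {A : ℕ → Set} → (∀ n → A n) → mem A
    mem-∀ a = upward _ _ whole (λ n _ → a n)

    mem-const : {P : Set} → P ⇔ mem (λ _ → P)
    mem-const = mk⇔ (λ p → mem-∀ (λ _ → p)) (λ m → proj₂ (mem⇒∃ m))

    mem-¬ : {A : ℕ → Set} → (¬ mem A) ⇔ mem (λ n → ¬ A n)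
    mem-¬ {A} = mk⇔ complement (λ m¬ mA → proper (upward _ _ (inter _ _ mA m¬) (λ n (a , ¬a) → ¬a a)))
      where
      complement : ¬ mem A → mem (λ n → ¬ A n)
      complement ¬mA with ultra A
      ... | inj₁ mA = ⊥-elim (¬mA mA)
      ... | inj₂ m¬ = m¬

    mem-× : {A B : ℕ → Set} → (mem A × mem B) ⇔ mem (λ n → A n × B n)
    mem-× = mk⇔ (λ (a , b) → inter _ _ a b)
                (λ m → upward _ _ m (λ n → proj₁) , upward _ _ m (λ n → proj₂))

    mem-⊎ : {A B : ℕ → Set} → (mem A ⊎ mem B) ⇔ mem (λ n → A n ⊎ B n)
    mem-⊎ {A} {B} = mk⇔ (λ { (inj₁ a) → upward _ _ a (λ n → inj₁) ; (inj₂ b) → upward _ _ b (λ n → inj₂) })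
                        split
      where
      split : mem (λ n → A n ⊎ B n) → mem A ⊎ mem B
      split m with ultra A | ultra B
      ... | inj₁ a | _ = inj₁ a
      ... | _ | inj₁ b = inj₂ b
      ... | inj₂ ¬a | inj₂ ¬b = ⊥-elim (proper (upward _ _ (inter _ _ m (inter _ _ ¬a ¬b))
              λ { n (inj₁ a , ¬a , _) → ¬a a ; n (inj₂ b , _ , ¬b) → ¬b b }))

    mem-→ : {A B : ℕ → Set} → (mem A → mem B) ⇔ mem (λ n → A n → B n)
    mem-→ {A} {B} = mk⇔ lift (λ m a → upward _ _ (inter _ _ m a) (λ n (f , x) → f x))
      where
      lift : (mem A → mem B) → mem (λ n → A n → B n)
      lift f with ultra A
      ... | inj₁ a = upward _ _ (f a) (λ n b _ → b)
      ... | inj₂ ¬a = upward _ _ ¬a (λ n ¬An An → ⊥-elim (¬An An))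

module Bouquet (lem : ∀ {ℓ} → ExcludedMiddle ℓ) (S : ℕ → BiSpace)
  (xs : (n : ℕ) → BiSpace.Carrier (S n))
  (Ys : (n : ℕ) → BiSpace.Carrier (S n) → Bool)
  (x∈Y : ∀ n → Ys n (xs n) ≡ true)
  (Y-open : ∀ n → BiSpace.O0 (S n) (Ys n))
  (Y∖x-open : ∀ n → OpenP (BiSpace.O0 (S n)) (λ p → Ys n p ≡ true × p ≢ xs n))
  (𝒰 : NPUltrafilter) where

  open BiSpace
  open Classical lem
  open UltrafilterLemmas 𝒰
  open Ultrabouquet S xs Ys 𝒰
  open NPUltrafilter 𝒰

  X : ℕ → Set
  X n = Carrier (S n)

  inn-injective : ∀ {n} {p q : X n} .{p≢x : p ≢ xs n} .{q≢x : q ≢ xs n} →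
                  inn n p p≢x ≡ inn n q q≢x → p ≡ q
  inn-injective refl = refl

  Agree : (n : ℕ) → Subset Pt → Subset (X n) → Set
  Agree n A B = ∀ q .(q≢x : q ≢ xs n) → Ys n q ≡ true → A (inn n q q≢x) ⇔ B q

  Agree-× : ∀ {n} {A A' : Subset Pt} {B B' : Subset (X n)} →
            Agree n A B → Agree n A' B' → Agree n (λ y → A y × A' y) (λ q → B q × B' q)
  Agree-× ag ag' q q≢x Yq = ag q q≢x Yq ×-⇔ ag' q q≢x Yq

  Agree-resX : ∀ {n} {U : Pt → Bool} {W : X n → Bool} → (∀ q → W q ≡ true ⇔ resX U n q) →
               Agree n (λ y → U y ≡ true) (λ q → W q ≡ true)
  Agree-resX {n} {U} W⇔U q q≢x _ =
    mk⇔ (λ u → from (W⇔U q) (inj₂ (¬-recompute q≢x , u))) (λ w → inner (to (W⇔U q) w))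
    where
    inner : resX U n q → U (inn n q q≢x) ≡ true
    inner (inj₁ (q≡x , _)) = ⊥-elim-irr (q≢x q≡x)
    inner (inj₂ (_ , u)) = u

  embed : (n : ℕ) → Subset (X n) → Subset Pt
  embed n P y = Σ (X n) λ q → Σ (q ≢ xs n) λ q≢x → y ≡ inn n q q≢x × P q

  embed-τ0 : ∀ {n} {P : Subset (X n)} → OpenP (O0 (S n)) P → (∀ q → P q → Ys n q ≡ true × q ≢ xs n) →
             τ0 (χ (embed n P))
  embed-τ0 {n} {P} oP P⊆Y∖x = cut , λ e → ⊥-elim (star∉ (to (χ-⇔ {P = embed n P}) e))
    where
    star∉ : ¬ embed n P star
    star∉ (_ , _ , () , _)
    cut : ∀ m → OpenP (O0 (S m)) (cutY (χ (embed n P)) m)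
    cut m with m ≟ n
    ... | yes refl = OpenP-resp oP λ r → mk⇔
            (λ Pr → let (Yr , r≢x) = P⊆Y∖x r Pr in
                    Yr , r≢x , from (χ-⇔ {P = embed n P}) (r , r≢x , refl , Pr))
            (λ (_ , r≢x , e) → preimage (to (χ-⇔ {P = embed n P} {x = inn n r r≢x}) e))
      where
      preimage : ∀ {r} .{r≢x : r ≢ xs n} → embed n P (inn n r r≢x) → P r
      preimage (_ , _ , eq , Pq) = subst P (sym (inn-injective eq)) Pq
    ... | no m≢n = OpenP-resp (OpenP-∅ (top0 (S m))) λ r → mk⇔ ⊥-elim
            (λ (_ , r≢x , e) → elsewhere (to (χ-⇔ {P = embed n P} {x = inn m r r≢x}) e))
      where
      elsewhere : ∀ {r} .{r≢x : r ≢ xs m} → ¬ embed n P (inn m r r≢x)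
      elsewhere (_ , _ , refl , _) = m≢n refl

  glue : (F : ∀ m → Subset (X m)) → Set → Subset Pt
  glue F s star = s
  glue F s (inn m q _) = F m q

  resX-glue : ∀ {F s m} → F m (xs m) ⇔ s → ∀ r → F m r ⇔ resX (χ (glue F s)) m r
  resX-glue {F} {s} {m} Fx⇔s r = mk⇔ toRes fromRes
    where
    toRes : F m r → resX (χ (glue F s)) m r
    toRes Fr with lem {P = r ≡ xs m}
    ... | yes refl = inj₁ (refl , from (χ-⇔ {P = glue F s} {x = star}) (to Fx⇔s Fr))
    ... | no r≢x = inj₂ (r≢x , from (χ-⇔ {P = glue F s} {x = inn m r r≢x}) Fr)
    fromRes : resX (χ (glue F s)) m r → F m r
    fromRes (inj₁ (refl , e)) = from Fx⇔s (to (χ-⇔ {P = glue F s} {x = star}) e)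
    fromRes (inj₂ (r≢x , e)) = to (χ-⇔ {P = glue F s} {x = inn m r r≢x}) e

  glue-τ1 : ∀ {F s} → (∀ m → OpenP (O1 (S m)) (F m)) → (∀ m → F m (xs m) ⇔ s) → τ1 (χ (glue F s))
  glue-τ1 {F} {s} oF Fx⇔s m = OpenP-resp (oF m) (resX-glue {F} {s} (Fx⇔s m))

  glue-τ0 : ∀ {F} → (∀ m → OpenP (O0 (S m)) (F m)) → (∀ m q → F m q → Ys m q ≡ true) →
            mem (λ m → F m (xs m)) → τ0 (χ (glue F ⊤))
  glue-τ0 {F} oF F⊆Y mFx = cut , λ _ → upward _ _ mFx resY-open
    where
    cut : ∀ m → OpenP (O0 (S m)) (cutY (χ (glue F ⊤)) m)
    cut m = OpenP-resp (OpenP-∩ (top0 (S m)) (oF m) (Y∖x-open m)) λ r → mk⇔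
      (λ (Fr , Yr , r≢x) → Yr , r≢x , from (χ-⇔ {P = glue F ⊤} {x = inn m r r≢x}) Fr)
      (λ (Yr , r≢x , e) → to (χ-⇔ {P = glue F ⊤} {x = inn m r r≢x}) e , Yr , r≢x)
    resY-open : ∀ m → F m (xs m) → OpenP (O0 (S m)) (resY (χ (glue F ⊤)) m)
    resY-open m Fx = OpenP-resp (oF m) λ r → mk⇔
      (λ Fr → F⊆Y m r Fr , to (resX-glue {F} (mk⇔ _ (λ _ → Fx)) r) Fr)
      (λ (_ , res) → from (resX-glue {F} (mk⇔ _ (λ _ → Fx)) r) res)

  Agree-glue : ∀ {F s} n → Agree n (λ y → χ (glue F s) y ≡ true) (F n)
  Agree-glue {F} {s} n q q≢x _ = χ-⇔ {P = glue F s} {x = inn n q q≢x}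

  der-inn : ∀ {n} {A : Subset Pt} {B : Subset (X n)} {p} .{p≢x : p ≢ xs n} →
            Agree n A B → Ys n p ≡ true → der τ0 A (inn n p p≢x) ⇔ der (O0 (S n)) B p
  der-inn {n} {A} {B} {p} {p≢x} ag Yp = mk⇔ toₙ fromₙ
    where
    W∩Y∖x : (X n → Bool) → Subset (X n)
    W∩Y∖x W q = W q ≡ true × Ys n q ≡ true × q ≢ xs n
    toₙ : der τ0 A (inn n p p≢x) → der (O0 (S n)) B p
    toₙ d W OW Wp with d (χ (embed n (W∩Y∖x W)))
                         (embed-τ0 (OpenP-∩ (top0 (S n)) (OpenP-char OW) (Y∖x-open n)) (λ _ → proj₂))
                         (from (χ-⇔ {P = embed n (W∩Y∖x W)})
                               (p , ¬-recompute p≢x , refl , Wp , Yp , ¬-recompute p≢x))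
    ... | y , Uy , Ay , y≢p with to (χ-⇔ {P = embed n (W∩Y∖x W)} {x = y}) Uy
    ... | q , q≢x , refl , Wq , Yq , _ = q , Wq , to (ag q q≢x Yq) Ay , λ { refl → y≢p refl }
    fromₙ : der (O0 (S n)) B p → der τ0 A (inn n p p≢x)
    fromₙ d U τU Up with der-OpenP d (proj₁ τU n) (Yp , ¬-recompute p≢x , Up)
    ... | q , (Yq , q≢x , Uq) , Bq , q≢p =
      inn n q q≢x , Uq , from (ag q q≢x Yq) Bq , λ e → q≢p (inn-injective e)

  der-star : ∀ {A : Subset Pt} {B : ∀ m → Subset (X m)} → (∀ m → Agree m A (B m)) →
             der τ0 A star ⇔ mem (λ m → der (O0 (S m)) (B m) (xs m))
  der-star {A} {B} ag = mk⇔ toᵤ fromᵤ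
    where
    D : ℕ → Set
    D m = der (O0 (S m)) (B m) (xs m)
    isolating : ∀ m → Σ (X m → Bool) λ W → O0 (S m) W × (¬ D m → W (xs m) ≡ true) ×
                                              (∀ q → W q ≡ true → B m q → q ≢ xs m → ⊥)
    isolating m with lem {P = D m}
    ... | yes d = (λ _ → false) , IsTopology.empty-open (top0 (S m)) _ (λ _ → refl) ,
                  (λ ¬d → ⊥-elim (¬d d)) , λ _ ()
    ... | no ¬d = let (W , OW , Wx , sep) = ¬der⇒isolating ¬d in W , OW , (λ _ → Wx) , sep
    W : ∀ m → X m → Bool
    W m = proj₁ (isolating m)
    F : ∀ m → Subset (X m)
    F m q = W m q ≡ true × Ys m q ≡ true
    F-open : ∀ m → OpenP (O0 (S m)) (F m)
    F-open m = OpenP-∩ (top0 (S m)) (OpenP-char (proj₁ (proj₂ (isolating m)))) (OpenP-char (Y-open m))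
    F-at-x : ∀ m → ¬ D m → F m (xs m)
    F-at-x m ¬d = proj₁ (proj₂ (proj₂ (isolating m))) ¬d , x∈Y m
    F-separates : ∀ m q → F m q → B m q → q ≢ xs m → ⊥
    F-separates m q (Wq , _) = proj₂ (proj₂ (proj₂ (isolating m))) q Wq
    toᵤ : der τ0 A star → mem D
    toᵤ d with ultra D
    ... | inj₁ mD = mD
    ... | inj₂ m¬D with d (χ (glue F ⊤)) (glue-τ0 F-open (λ _ _ → proj₂) (upward _ _ m¬D F-at-x))
                          (from (χ-⇔ {P = glue F ⊤} {x = star}) tt)
    ... | star , _ , _ , y≢star = ⊥-elim (y≢star refl)
    ... | inn m q q≢x , Uy , Ay , _ with to (χ-⇔ {P = glue F ⊤} {x = inn m q q≢x}) Uy
    ... | Fq@(_ , Yq) = ⊥-elim (F-separates m q Fq (to (ag m q q≢x Yq) Ay) (¬-recompute q≢x))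
    fromᵤ : mem D → der τ0 A star
    fromᵤ mD U τU Us with mem⇒∃ (inter _ _ (proj₂ τU Us) mD)
    ... | m , resY-open , dₘ with der-OpenP dₘ resY-open (x∈Y m , inj₁ (refl , Us))
    ... | q , (_ , inj₁ (q≡x , _)) , _ , q≢x = ⊥-elim (q≢x q≡x)
    ... | q , (Yq , inj₂ (q≢x , Uq)) , Bq , _ = inn m q q≢x , Uq , from (ag m q q≢x Yq) Bq , λ ()

  eˣ : Subset Pt → Subset Pt → Subset Pt
  eˣ = Semantics.e τ0 τ1

  e : (n : ℕ) → Subset (X n) → Subset (X n) → Subset (X n)
  e n = Semantics.e (O0 (S n)) (O1 (S n))

  extend : (n : ℕ) → (X n → Bool) → (m : ℕ) → Subset (X m)
  extend n W m q with m ≟ n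
  ... | yes refl = W q ≡ true
  ... | no _ = W (xs n) ≡ true

  extend-open : ∀ {n W} → O1 (S n) W → ∀ m → OpenP (O1 (S m)) (extend n W m)
  extend-open {n} {W} OW m with m ≟ n
  ... | yes refl = OpenP-char OW
  ... | no _ = OpenP-const (top1 (S m)) (W (xs n) ≡ true)

  extend-at-x : ∀ {n W} m → extend n W m (xs m) ⇔ (W (xs n) ≡ true)
  extend-at-x {n} m with m ≟ n
  ... | yes refl = ⇔-id _
  ... | no _ = ⇔-id _

  extend-self : ∀ {n W} q → extend n W n q ⇔ (W q ≡ true)
  extend-self {n} q with n ≟ n
  ... | yes refl = ⇔-id _
  ... | no n≢n = ⊥-elim (n≢n refl)

  patch : Bool → (∀ m → X m → Bool) → ∀ m → Subset (X m)
  patch b W m q with W m (xs m) Bool.≟ b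
  ... | yes _ = W m q ≡ true
  ... | no _ = b ≡ true

  patch-open : ∀ {b W} → (∀ m → O1 (S m) (W m)) → ∀ m → OpenP (O1 (S m)) (patch b W m)
  patch-open {b} {W} OW m with W m (xs m) Bool.≟ b
  ... | yes _ = OpenP-char (OW m)
  ... | no _ = OpenP-const (top1 (S m)) (b ≡ true)

  patch-at-x : ∀ {b W} m → patch b W m (xs m) ⇔ (b ≡ true)
  patch-at-x {b} {W} m with W m (xs m) Bool.≟ b
  ... | yes Wx≡b = mk⇔ (trans (sym Wx≡b)) (trans Wx≡b)
  ... | no _ = ⇔-id _

  patch-agrees : ∀ {b W m} → W m (xs m) ≡ b → ∀ q → patch b W m q ⇔ (W m q ≡ true)
  patch-agrees {b} {W} {m} Wx≡b q with W m (xs m) Bool.≟ b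
  ... | yes _ = ⇔-id _
  ... | no Wx≢b = ⊥-elim (Wx≢b Wx≡b)

  e-inn : ∀ {n} {A A' : Subset Pt} {B B' : Subset (X n)} {p} .{p≢x : p ≢ xs n} →
          Agree n A B → Agree n A' B' → Ys n p ≡ true → eˣ A A' (inn n p p≢x) ⇔ e n B B' p
  e-inn {n} {A} {A'} {B} {B'} {p} {p≢x} ag ag' Yp = mk⇔ toₙ fromₙ
    where
    restrict : {U : Pt → Bool} {W : X n → Bool} → Agree n (λ y → U y ≡ true) (λ q → W q ≡ true) →
               der τ0 (λ y → A y × U y ≡ true) (inn n p p≢x) ⇔ der (O0 (S n)) (λ q → B q × W q ≡ true) p
             × der τ0 (λ y → A' y × U y ≡ true) (inn n p p≢x) ⇔ der (O0 (S n)) (λ q → B' q × W q ≡ true) p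
    restrict {U} agree = der-inn (Agree-× {A = A} {A' = λ y → U y ≡ true} ag agree) Yp
                       , der-inn (Agree-× {A = A'} {A' = λ y → U y ≡ true} ag' agree) Yp
    toₙ : eˣ A A' (inn n p p≢x) → e n B B' p
    toₙ h W OW d = to (proj₂ (restrict {U} agree))
                      (h U (glue-τ1 (extend-open OW) extend-at-x) (from (proj₁ (restrict {U} agree)) d))
      where
      U : Pt → Bool
      U = χ (glue (extend n W) (W (xs n) ≡ true))
      agree : Agree n (λ y → U y ≡ true) (λ q → W q ≡ true)
      agree q q≢x Yq = extend-self {n} {W} q ⇔-∘ Agree-glue {extend n W} {W (xs n) ≡ true} n q q≢x Yq
    fromₙ : e n B B' p → eˣ A A' (inn n p p≢x)
    fromₙ h U τU d = from (proj₂ (restrict {U} agree))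
                          (h (proj₁ (τU n)) (proj₁ (proj₂ (τU n))) (to (proj₁ (restrict {U} agree)) d))
      where
      agree : Agree n (λ y → U y ≡ true) (λ q → proj₁ (τU n) q ≡ true)
      agree = Agree-resX {n} {U} (proj₂ (proj₂ (τU n)))

  module _ {A A' : Subset Pt} {B B' : ∀ m → Subset (X m)}
           (ag : ∀ m → Agree m A (B m)) (ag' : ∀ m → Agree m A' (B' m)) where

    private
      H : ℕ → Set
      H m = e m (B m) (B' m) (xs m)

      Refutes : (m : ℕ) → (X m → Bool) → Set
      Refutes m W = der (O0 (S m)) (λ q → B m q × W q ≡ true) (xs m)
                  × ¬ der (O0 (S m)) (λ q → B' m q × W q ≡ true) (xs m)

      refutation : ∀ m → Σ (X m → Bool) λ W → O1 (S m) W × (¬ H m → Refutes m W)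
      refutation m with lem {P = Σ (X m → Bool) λ W → O1 (S m) W × Refutes m W}
      ... | yes (W , OW , r) = W , OW , λ _ → r
      ... | no ¬r = (λ _ → true) , IsTopology.whole-open (top1 (S m)) _ (λ _ → refl) , λ ¬h → ⊥-elim (¬h h)
        where
        h : H m
        h W OW dB with lem {P = der (O0 (S m)) (λ q → B' m q × W q ≡ true) (xs m)}
        ... | yes dB' = dB'
        ... | no ¬dB' = ⊥-elim (¬r (W , OW , dB , ¬dB'))

      W : ∀ m → X m → Bool
      W m = proj₁ (refutation m)

      -- A τ¹-open set contains x_* iff its restrictions contain the x_n, so the
      -- refuting sets W m can only be glued over m where W m (xs m) takes one value b.
      K : Bool → ℕ → Set
      K b m = ¬ H m × W m (xs m) ≡ b

      choose-b : mem (λ m → ¬ H m) → Σ Bool λ b → mem (K b)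
      choose-b m¬H with ultra (K true)
      ... | inj₁ mK = true , mK
      ... | inj₂ m¬K = false , upward _ _ (inter _ _ m¬H m¬K)
                                 λ m (¬h , ¬k) → ¬h , ¬-not (λ Wx → ¬k (¬h , Wx))

      ¬mem-K : ∀ b → mem (K b) → ¬ eˣ A A' star
      ¬mem-K b mK h = let (m , k , dB') = mem⇒∃ (inter _ _ mK mB') in
        proj₂ (refutes m k) (der-mono dB' λ q (B'q , Fq) → B'q , to (patch-agrees (proj₂ k) q) Fq)
        where
        F : ∀ m → Subset (X m)
        F = patch b W
        U : Pt → Bool
        U = χ (glue F (b ≡ true))
        agree : ∀ m → Agree m (λ y → U y ≡ true) (F m)
        agree = Agree-glue {F} {b ≡ true}
        refutes : ∀ m → K b m → Refutes m (W m)
        refutes m (¬h , _) = proj₂ (proj₂ (refutation m)) ¬h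
        dA : der τ0 (λ y → A y × U y ≡ true) star
        dA = from (der-star (λ m → Agree-× {A = A} {A' = λ y → U y ≡ true} (ag m) (agree m)))
                  (upward _ _ mK λ m k → der-mono (proj₁ (refutes m k))
                                           λ q (Bq , w) → Bq , from (patch-agrees (proj₂ k) q) w)
        mB' : mem (λ m → der (O0 (S m)) (λ q → B' m q × F m q) (xs m))
        mB' = to (der-star (λ m → Agree-× {A = A'} {A' = λ y → U y ≡ true} (ag' m) (agree m)))
                 (h U (glue-τ1 (patch-open (λ m → proj₁ (proj₂ (refutation m)))) patch-at-x) dA)

    e-star : eˣ A A' star ⇔ mem H
    e-star = mk⇔ toᵤ fromᵤ
      where
      toᵤ : eˣ A A' star → mem H
      toᵤ h with ultra H
      ... | inj₁ mH = mH
      ... | inj₂ m¬H = let (b , mK) = choose-b m¬H in ⊥-elim (¬mem-K b mK h)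
      fromᵤ : mem H → eˣ A A' star
      fromᵤ mH U τU d = from (der-star agreeA') (upward _ _ (inter _ _ (to (der-star agreeA) d) mH)
                                                   λ m (dₘ , h) → h (proj₁ (τU m)) (proj₁ (proj₂ (τU m))) dₘ)
        where
        agree : ∀ m → Agree m (λ y → U y ≡ true) (λ q → proj₁ (τU m) q ≡ true)
        agree m = Agree-resX {m} {U} (proj₂ (proj₂ (τU m)))
        agreeA : ∀ m → Agree m (λ y → A y × U y ≡ true) (λ q → B m q × proj₁ (τU m) q ≡ true)
        agreeA m = Agree-× {A = A} {A' = λ y → U y ≡ true} (ag m) (agree m)
        agreeA' : ∀ m → Agree m (λ y → A' y × U y ≡ true) (λ q → B' m q × proj₁ (τU m) q ≡ true)
        agreeA' m = Agree-× {A = A'} {A' = λ y → U y ≡ true} (ag' m) (agree m)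

  record Transfer (A : Subset Pt) (B : ∀ m → Subset (X m)) : Set where
    field
      inner  : ∀ m → Agree m A (B m)
      atStar : A star ⇔ mem (λ m → B m (xs m))

  open Transfer public

  module _ {A : Subset Pt} {B : ∀ m → Subset (X m)} where

    Transfer-¬ : Transfer A B → Transfer (λ y → ¬ A y) (λ m q → ¬ B m q)
    Transfer-¬ t .inner m q q≢x Yq = ¬-cong-⇔ (t .inner m q q≢x Yq)
    Transfer-¬ t .atStar = mem-¬ ⇔-∘ ¬-cong-⇔ (t .atStar)

    Transfer-der : Transfer A B → Transfer (der τ0 A) (λ m → der (O0 (S m)) (B m))
    Transfer-der t .inner m q q≢x Yq = der-inn (t .inner m) Yq
    Transfer-der t .atStar = der-star (t .inner)

  module _ {A A' : Subset Pt} {B B' : ∀ m → Subset (X m)} where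

    Transfer-× : Transfer A B → Transfer A' B' → Transfer (λ y → A y × A' y) (λ m q → B m q × B' m q)
    Transfer-× t t' .inner m = Agree-× {A = A} {A' = A'} (t .inner m) (t' .inner m)
    Transfer-× t t' .atStar = mem-× ⇔-∘ (t .atStar ×-⇔ t' .atStar)

    Transfer-⊎ : Transfer A B → Transfer A' B' → Transfer (λ y → A y ⊎ A' y) (λ m q → B m q ⊎ B' m q)
    Transfer-⊎ t t' .inner m q q≢x Yq = t .inner m q q≢x Yq ⊎-⇔ t' .inner m q q≢x Yq
    Transfer-⊎ t t' .atStar = mem-⊎ ⇔-∘ (t .atStar ⊎-⇔ t' .atStar)

    Transfer-→ : Transfer A B → Transfer A' B' → Transfer (λ y → A y → A' y) (λ m q → B m q → B' m q)
    Transfer-→ t t' .inner m q q≢x Yq = →-cong-⇔ (t .inner m q q≢x Yq) (t' .inner m q q≢x Yq)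
    Transfer-→ t t' .atStar = mem-→ ⇔-∘ →-cong-⇔ (t .atStar) (t' .atStar)

    Transfer-e : Transfer A B → Transfer A' B' → Transfer (eˣ A A') (λ m → e m (B m) (B' m))
    Transfer-e t t' .inner m q q≢x Yq = e-inn (t .inner m) (t' .inner m) Yq
    Transfer-e t t' .atStar = e-star (t .inner) (t' .inner)

  Transfer-const : (P : Set) → Transfer (λ _ → P) (λ _ _ → P)
  Transfer-const P .inner m q q≢x Yq = ⇔-id P
  Transfer-const P .atStar = mem-const

  restrictV : (ℕ → Subset Pt) → (m : ℕ) → ℕ → Subset (X m)
  restrictV V m i q = (q ≡ xs m × V i star) ⊎ Σ (q ≢ xs m) λ q≢x → V i (inn m q q≢x)

  Transfer-var : ∀ V i → Transfer (V i) (λ m → restrictV V m i)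
  Transfer-var V i .inner m q q≢x Yq = mk⇔ (λ v → inj₂ (¬-recompute q≢x , v)) λ
    { (inj₁ (q≡x , _)) → ⊥-elim-irr (q≢x q≡x)
    ; (inj₂ (_ , v)) → v }
  Transfer-var V i .atStar = mem-resp at-x ⇔-∘ mem-const
    where
    at-x : ∀ m → V i star ⇔ restrictV V m i (xs m)
    at-x m = mk⇔ (λ v → inj₁ (refl , v))
                 λ { (inj₁ (_ , v)) → v ; (inj₂ (x≢x , _)) → ⊥-elim (x≢x refl) }

  ⟦_⟧ˣ : Formula → (ℕ → Subset Pt) → Subset Pt
  ⟦_⟧ˣ = Semantics.⟦_⟧ τ0 τ1

  ⟦_⟧_at_ : Formula → (ℕ → Subset Pt) → (m : ℕ) → Subset (X m)
  ⟦ φ ⟧ V at m = Semantics.⟦_⟧ (O0 (S m)) (O1 (S m)) φ (restrictV V m)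

  transfer : ∀ φ V → Transfer (⟦ φ ⟧ˣ V) (⟦ φ ⟧ V at_)
  transfer (var i) V = Transfer-var V i
  transfer ⊤f V = Transfer-const ⊤
  transfer ⊥f V = Transfer-const ⊥
  transfer (¬f φ) V = Transfer-¬ (transfer φ V)
  transfer (φ ∧f ψ) V = Transfer-× (transfer φ V) (transfer ψ V)
  transfer (φ ∨f ψ) V = Transfer-⊎ (transfer φ V) (transfer ψ V)
  transfer (φ ⇒f ψ) V = Transfer-→ (transfer φ V) (transfer ψ V)
  transfer (□f φ) V = Transfer-¬ (Transfer-der (Transfer-¬ (transfer φ V)))
  transfer (◇f φ) V = Transfer-der (transfer φ V)
  transfer (φ ▷f ψ) V = Transfer-e (transfer φ V) (transfer ψ V)

  singleton-τ0 : ∀ {m q} .{q≢x : q ≢ xs m} → Ys m q ≡ false → τ0 (χ (_≡ inn m q q≢x))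
  singleton-τ0 {m} {q} {q≢x} Yq = cut , λ e → ⊥-elim (star≢ (to (χ-⇔ {P = _≡ inn m q q≢x}) e))
    where
    star≢ : star ≢ inn m q q≢x
    star≢ ()
    outsideY : ∀ {k r} .{r≢x : r ≢ xs k} → Ys k r ≡ true → inn k r r≢x ≢ inn m q q≢x
    outsideY Yr refl with trans (sym Yr) Yq
    ... | ()
    cut : ∀ k → OpenP (O0 (S k)) (cutY (χ (_≡ inn m q q≢x)) k)
    cut k = OpenP-resp (OpenP-∅ (top0 (S k))) λ r → mk⇔ ⊥-elim
      λ (Yr , r≢x , e) → outsideY Yr (to (χ-⇔ {P = _≡ inn m q q≢x} {x = inn k r r≢x}) e)

  outsideY-isolated : ∀ {m q} .{q≢x : q ≢ xs m} → Ys m q ≡ false → Isolated τ0 (inn m q q≢x)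
  outsideY-isolated {m} {q} {q≢x} Yq A d with d _ (singleton-τ0 Yq) (from (χ-⇔ {P = _≡ inn m q q≢x}) refl)
  ... | y , Uy , _ , y≢ = y≢ (to (χ-⇔ {P = _≡ inn m q q≢x} {x = y}) Uy)

theorem4p12 : (lem : ∀ {ℓ} → ExcludedMiddle ℓ)
    → (S : ℕ → BiSpace)
    → (∀ n → Scattered (BiSpace.O0 (S n)))
    → (xs : (n : ℕ) → BiSpace.Carrier (S n))
    → (Ys : (n : ℕ) → BiSpace.Carrier (S n) → Bool)
    → (∀ n → Ys n (xs n) ≡ true)
    → (∀ n → BiSpace.O0 (S n) (Ys n))
    → (∀ n → OpenP (BiSpace.O0 (S n)) (λ p → Ys n p ≡ true × p ≢ xs n))
    → (𝒰 : NPUltrafilter)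
    → (φ : Formula)
    → (∀ n → ValidIn (S n) φ)
    → Ultrabouquet.Valid S xs Ys 𝒰 φ
theorem4p12 lem S scattered xs Ys x∈Y Y-open Y∖x-open 𝒰 φ valid V = valid-at
  where
  open Bouquet lem S xs Ys x∈Y Y-open Y∖x-open 𝒰
  open Ultrabouquet S xs Ys 𝒰
  open Classical.UltrafilterLemmas lem 𝒰 using (mem-∀)

  valid-at : ∀ x → ⟦ φ ⟧ˣ V x
  valid-at star = from (atStar (transfer φ V)) (mem-∀ λ m → valid m _ (xs m))
  valid-at (inn m q q≢x) with Ys m q in Yq
  ... | true = from (inner (transfer φ V) m q q≢x Yq) (valid m _ q)
  ... | false = from (⟦⟧-isolated τ0 τ1 (outsideY-isolated Yq) φ V)
                     (valid⇒isolatedEval {S 0} {φ} (valid 0)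
                        (Scattered⇒isolated (scattered 0) (BiSpace.point (S 0))) _)
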